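{- Let $\mathbf c=(c_1,\dots,c_n)$ be an IP sequence with $c_1\ge3$, and let $r\in[n]$. Define $w\colon\binom{[n]}{\le r}\to\mathbb N$ by \[w(A)=\left|\left\{L\in\mathcal L_{\mathbf c}^{(r)}\colon L\cap([n]\times[1])=A\times[1]\right\}\right|\] for each $A\in\binom{[n]}{\le r}$. Then: (i) $w(A)\ge2w(A')$ for any $A,A'\in\binom{[n]}{\le r}$ with $A\subsetneq A'$; (ii) $w(\delta_{i,j}(A))\ge w(A)$ for any $A\in\binom{[n]}{\le r}$ and any $i,j\in[n]$ with $i<j$.
   Context: An IP sequence is $(c_1,\dots,c_n)$ with $1\le c_1\le\dots\le c_n$ integers; $[k]=\{1,\dots,k\}$. $\binom{X}{\le r}=\{A\subseteq X\colon|A|\le r\}$. For an IP sequence $\mathbf c$ and integer $r$, $\mathcal L_{\mathbf c}^{(r)}=\{\{(i_1,a_{i_1}),\dots,(i_r,a_{i_r})\}\colon\{i_1,\dots,i_r\}\text{ an }r\text{ -subset of }[n],\ a_{i_j}\in[c_{i_j}]\}$. For $i,j\in[n]$, $\delta_{i,j}(A)=(A\setminus\{j\})\cup\{i\}$ if $j\in A$ and $i\notin A$, and $\delta_{i,j}(A)=A$ otherwise. -}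

module Defs where

open import Data.Nat using (ℕ; zero; suc; _≤_; _+_; _≡ᵇ_)
open import Data.Bool using (Bool; true; false; _∧_; not; _xor_; if_then_else_)
open import Data.Maybe using (Maybe; just; nothing; is-just)
open import Data.Fin using (Fin; toℕ) renaming (_≤_ to _≤ᶠ_)
open import Data.Fin.Subset using (Subset; inside; outside)
open import Data.Fin.Subset.Properties using (_∈?_)
open import Data.Vec as Vec using (Vec; []; _∷_; lookup; _[_]≔_)
open import Data.List as List using (List; length; filterᵇ; concatMap; upTo; allFin)
open import Data.Bool.ListAction using (and)
open import Data.Product using (_×_)
open import Relation.Nullary using (yes; no)

-- An IP sequence c = (c_1,…,c_n), indexed by Fin n (0-based: index k ↔ paper's k+1):
-- 1 ≤ c_1 ≤ … ≤ c_n.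
IPSeq : ∀ {n} → (Fin n → ℕ) → Set
IPSeq {n} c = (∀ i → 1 ≤ c i) × (∀ i j → i ≤ᶠ j → c i ≤ c j)

-- A partial choice g : index i ↦ nothing (i not used) or just a (the pair (i,a)).
-- The set L = {(i,a) : g i = just a} determines g and vice versa, so a member
-- of L_c^{(r)} is exactly such a g with a ∈ [c_i] = {1,…,c_i} whenever g i = just a,
-- and with exactly r indices used.
PChoice : ℕ → Set
PChoice n = Vec (Maybe ℕ) n

-- All partial choices with values in [c_i] (each occurs exactly once).
choices : ∀ n → (Fin n → ℕ) → List (PChoice n)
choices zero    c = [] List.∷ List.[]
choices (suc n) c =
  concatMap (λ x → List.map (x ∷_) (choices n (λ i → c (Fin.suc i))))
            (nothing List.∷ List.map (λ a → just (suc a)) (upTo (c Fin.zero)))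
  where import Data.Fin as Fin

size : ∀ {n} → PChoice n → ℕ
size []             = 0
size (nothing ∷ g)  = size g
size (just _ ∷ g)   = suc (size g)

isOne : Maybe ℕ → Bool
isOne (just (suc zero)) = true
isOne _                 = false

_==_ : Bool → Bool → Bool
a == b = not (a xor b)

-- L ∩ ([n]×[1]) = A × [1]  ⇔  for all i: (i,1) ∈ L iff i ∈ A
traceIs : ∀ {n} → PChoice n → Subset n → Bool
traceIs {n} g A = and (List.map (λ i → isOne (lookup g i) == lookup A i) (allFin n))

w : ∀ {n} → (Fin n → ℕ) → ℕ → Subset n → ℕ
w {n} c r A = length (filterᵇ (λ g → (size g ≡ᵇ r) ∧ traceIs g A) (choices n c))

δ : ∀ {n} → Fin n → Fin n → Subset n → Subset n
δ i j A with j ∈? A | i ∈? A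
... | yes _ | no _ = (A [ j ]≔ outside) [ i ]≔ inside
... | _     | _    = A

-- Deleting the pair (j,1) from a choice L with trace B gives a choice of size |L| - 1
-- with trace B ∖ {j}, and replacing (j,1) by one of the c_j - 1 pairs (j,a), a ≥ 2, gives
-- a choice of the same size with trace B ∖ {j}; every choice with trace B ∖ {j} arises
-- exactly once this way. Hence
--   w_r(B ∖ {j}) = w_{r+1}(B) + (c_j - 1) w_r(B)   for j ∈ B.
-- With c_j ≥ 3 this gives w_r(B ∖ {j}) ≥ 2 w_r(B), which together with monotonicity of w
-- yields (i). For (ii), put B = A ∪ {i}: then A = B ∖ {i} and δ_{i,j}(A) = B ∖ {j}, and
-- c_i ≤ c_j.
module Submission where

open import Defs
open import Data.Bool using (Bool; true; false; _∧_)
open import Data.Bool.ListAction using (and)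
open import Data.Bool.Properties using (∧-zeroʳ)
open import Data.Fin using (Fin; zero; suc; toℕ) renaming (_<_ to _<ᶠ_)
open import Data.Fin.Properties using (<⇒≢)
open import Data.Fin.Subset using (Subset; inside; outside; ∣_∣; _∈_; _∉_; _⊆_; _⊂_)
open import Data.Fin.Subset.Properties using (_∈?_; drop-∷-⊆)
open import Data.List as List using (List; length; filterᵇ; concatMap; upTo; applyUpTo; _++_)
open import Data.List.Properties using (length-++; filter-++; map-tabulate; map-applyUpTo; map-∘)
open import Data.Maybe using (Maybe; just; nothing)
open import Data.Nat using (ℕ; zero; suc; _≤_; _*_; _+_; _∸_; _≡ᵇ_; z≤n; >-nonZero)
open import Data.Nat.ListAction using (sum)
open import Data.Nat.Properties
  using (≤-refl; ≤-trans; <⇒≤; n≤1+n; m≤n+m; m≤n*m; +-identityʳ; *-zeroʳ; +-mono-≤; +-monoʳ-≤;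
         *-monoˡ-≤; *-monoʳ-≤; ∸-monoˡ-≤; module ≤-Reasoning)
open import Data.Nat.Solver using (module +-*-Solver)
open import Data.Product using (_×_; _,_)
open import Data.Vec using ([]; _∷_; lookup; _[_]≔_; here; there)
open import Data.Vec.Properties using ([]≔-idempotent; []≔-commutes; []≔-updates; []≔-minimal; []≔-lookup)
open import Function using (_∘_; id)
open import Relation.Nullary using (yes; no; contradiction)
open import Relation.Nullary.Decidable using (T?)
open import Relation.Binary.PropositionalEquality

private
  variable
    X : Set
    n : ℕ

count : (X → Bool) → List X → ℕ
count p xs = length (filterᵇ p xs)

count-++ : ∀ (p : X → Bool) xs ys → count p (xs ++ ys) ≡ count p xs + count p ys
count-++ p xs ys = trans (cong length (filter-++ (T? ∘ p) xs ys)) (length-++ (filterᵇ p xs))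

count-map : ∀ {Y : Set} (p : Y → Bool) (f : X → Y) xs → count p (List.map f xs) ≡ count (p ∘ f) xs
count-map p f List.[] = refl
count-map p f (x List.∷ xs) with p (f x)
... | true  = cong suc (count-map p f xs)
... | false = count-map p f xs

count-cong : ∀ {p q : X → Bool} → (∀ x → p x ≡ q x) → ∀ xs → count p xs ≡ count q xs
count-cong p≗q List.[] = refl
count-cong {p = p} {q} p≗q (x List.∷ xs) with p x | q x | p≗q x
... | true  | .true  | refl = cong suc (count-cong p≗q xs)
... | false | .false | refl = count-cong p≗q xs

count-false : ∀ (xs : List X) → count (λ _ → false) xs ≡ 0
count-false List.[]       = refl
count-false (x List.∷ xs) = count-false xs

count-concatMap : ∀ {Y : Set} (p : Y → Bool) (f : X → List Y) xs →
  count p (concatMap f xs) ≡ sum (List.map (count p ∘ f) xs)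
count-concatMap p f List.[]       = refl
count-concatMap p f (x List.∷ xs) =
  trans (count-++ p (f x) (concatMap f xs)) (cong (count p (f x) +_) (count-concatMap p f xs))

sum-applyUpTo-const : ∀ (f : ℕ → ℕ) {k} → (∀ a → f a ≡ k) → ∀ m → sum (applyUpTo f m) ≡ m * k
sum-applyUpTo-const f f≗k zero    = refl
sum-applyUpTo-const f f≗k (suc m) = cong₂ _+_ (f≗k 0) (sum-applyUpTo-const (f ∘ suc) (f≗k ∘ suc) m)

sum-upTo-tail-const : ∀ (f : ℕ → ℕ) → (∀ a → f (suc a) ≡ f 1) → ∀ k → 1 ≤ k →
  sum (List.map f (upTo k)) ≡ f 0 + (k ∸ 1) * f 1
sum-upTo-tail-const f tail-const (suc m) _ =
  cong (f 0 +_) (trans (cong sum (map-applyUpTo suc f m)) (sum-applyUpTo-const (f ∘ suc) tail-const m))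

count-choices-suc : ∀ (c : Fin (suc n) → ℕ) (q : PChoice (suc n) → Bool) → 1 ≤ c zero →
  (∀ a g → q (just (suc (suc a)) ∷ g) ≡ q (just 2 ∷ g)) →
  let G = choices n (c ∘ suc) in
  count q (choices (suc n) c) ≡
    count (q ∘ (nothing ∷_)) G + (count (q ∘ (just 1 ∷_)) G + (c zero ∸ 1) * count (q ∘ (just 2 ∷_)) G)
count-choices-suc {n} c q c₀≥1 q-tail = begin
  count q (concatMap F (nothing List.∷ List.map (just ∘ suc) (upTo (c zero))))
    ≡⟨ count-concatMap q F (nothing List.∷ List.map (just ∘ suc) (upTo (c zero))) ⟩
  count q (F nothing) + sum (List.map (count q ∘ F) (List.map (just ∘ suc) (upTo (c zero))))
    ≡⟨ cong₂ _+_ (count-map q _ G) (cong sum (sym (map-∘ (upTo (c zero))))) ⟩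
  count (q ∘ (nothing ∷_)) G + sum (List.map (count q ∘ F ∘ just ∘ suc) (upTo (c zero)))
    ≡⟨ cong (count (q ∘ (nothing ∷_)) G +_) (sum-upTo-tail-const _ tail-const (c zero) c₀≥1) ⟩
  count (q ∘ (nothing ∷_)) G + (count q (F (just 1)) + (c zero ∸ 1) * count q (F (just 2)))
    ≡⟨ cong₂ (λ a b → count (q ∘ (nothing ∷_)) G + (a + (c zero ∸ 1) * b)) (count-map q _ G) (count-map q _ G) ⟩
  count (q ∘ (nothing ∷_)) G + (count (q ∘ (just 1 ∷_)) G + (c zero ∸ 1) * count (q ∘ (just 2 ∷_)) G) ∎
  where
  open ≡-Reasoning
  G : List (PChoice n)
  G = choices n (c ∘ suc)
  F : Maybe ℕ → List (PChoice (suc n))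
  F x = List.map (x ∷_) G
  tail-const : ∀ a → count q (F (just (suc (suc a)))) ≡ count q (F (just 2))
  tail-const a = begin
    count q (F (just (suc (suc a))))        ≡⟨ count-map q _ G ⟩
    count (q ∘ (just (suc (suc a)) ∷_)) G  ≡⟨ count-cong (q-tail a) G ⟩
    count (q ∘ (just 2 ∷_)) G              ≡⟨ count-map q _ G ⟨
    count q (F (just 2))                    ∎

accepts : ℕ → Subset n → PChoice n → Bool
accepts r A g = (size g ≡ᵇ r) ∧ traceIs g A

traceIs-∷ : ∀ x (g : PChoice n) b A → traceIs (x ∷ g) (b ∷ A) ≡ (isOne x == b) ∧ traceIs g A
traceIs-∷ x g b A = cong ((isOne x == b) ∧_) (cong and
  (trans (map-tabulate suc (λ i → isOne (lookup (x ∷ g) i) == lookup (b ∷ A) i))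
         (sym (map-tabulate id (λ i → isOne (lookup g i) == lookup A i)))))

-- the test on the first entry is moved to the front, so that it computes
accepts-∷ : ∀ r x (g : PChoice n) b A →
  accepts r (b ∷ A) (x ∷ g) ≡ (isOne x == b) ∧ ((size (x ∷ g) ≡ᵇ r) ∧ traceIs g A)
accepts-∷ r x g b A rewrite traceIs-∷ x g b A with isOne x == b
... | true  = refl
... | false = ∧-zeroʳ (size (x ∷ g) ≡ᵇ r)

-- The first entry of a choice is unused, the pair (1,1), or one of the c₁ - 1 pairs (1,a), a ≥ 2.
weight : (Fin n → ℕ) → ℕ → Subset n → ℕ
weight c zero    []            = 1
weight c (suc r) []            = 0
weight c zero    (inside ∷ A)  = 0
weight c (suc r) (inside ∷ A)  = weight (c ∘ suc) r A
weight c zero    (outside ∷ A) = weight (c ∘ suc) zero A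
weight c (suc r) (outside ∷ A) = weight (c ∘ suc) (suc r) A + (c zero ∸ 1) * weight (c ∘ suc) r A

w≡weight : ∀ (c : Fin n → ℕ) → (∀ i → 1 ≤ c i) → ∀ r A → w c r A ≡ weight c r A
w≡weight c c≥1 zero    []      = refl
w≡weight c c≥1 (suc r) []      = refl
w≡weight {suc n} c c≥1 r (b ∷ A) =
  trans (count-choices-suc c (accepts r (b ∷ A)) (c≥1 zero)
          (λ a g → trans (accepts-∷ r (just (suc (suc a))) g b A) (sym (accepts-∷ r (just 2) g b A))))
  (trans (cong₂ _+_ (first nothing) (cong₂ (λ u v → u + d * v) (first (just 1)) (first (just 2))))
         (by-first-entry b r))
  where
  G : List (PChoice n)
  G = choices n (c ∘ suc)
  d : ℕ
  d = c zero ∸ 1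
  ih : ∀ r A → w (c ∘ suc) r A ≡ weight (c ∘ suc) r A
  ih = w≡weight (c ∘ suc) (c≥1 ∘ suc)
  first : ∀ x → count (λ g → accepts r (b ∷ A) (x ∷ g)) G
              ≡ count (λ g → (isOne x == b) ∧ ((size (x ∷ g) ≡ᵇ r) ∧ traceIs g A)) G
  first x = count-cong (λ g → accepts-∷ r x g b A) G
  none : count (λ _ → false) G ≡ 0
  none = count-false G
  d*none : d * count (λ _ → false) G ≡ 0
  d*none = trans (cong (d *_) none) (*-zeroʳ d)
  by-first-entry : ∀ b r →
    count (λ g → (isOne nothing == b) ∧ ((size g ≡ᵇ r) ∧ traceIs g A)) G
    + (count (λ g → (isOne (just 1) == b) ∧ ((suc (size g) ≡ᵇ r) ∧ traceIs g A)) G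
       + d * count (λ g → (isOne (just 2) == b) ∧ ((suc (size g) ≡ᵇ r) ∧ traceIs g A)) G)
    ≡ weight c r (b ∷ A)
  by-first-entry true  zero    = cong₂ _+_ none (cong₂ _+_ none d*none)
  by-first-entry true  (suc r) = cong₂ _+_ none (trans (cong₂ _+_ (ih r A) d*none) (+-identityʳ _))
  by-first-entry false zero    = trans (cong₂ _+_ (ih zero A) (cong₂ _+_ none d*none)) (+-identityʳ _)
  by-first-entry false (suc r) = cong₂ _+_ (ih (suc r) A) (cong₂ _+_ none (cong (d *_) (ih r A)))

∈⇒weight0≡0 : ∀ (c : Fin n → ℕ) {A j} → j ∈ A → weight c zero A ≡ 0
∈⇒weight0≡0 c               here        = refl
∈⇒weight0≡0 c {inside ∷ A}  (there _)   = refl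
∈⇒weight0≡0 c {outside ∷ A} (there j∈A) = ∈⇒weight0≡0 (c ∘ suc) j∈A

+-*-zeroʳ : ∀ a d → a + d * 0 ≡ a
+-*-zeroʳ a d = trans (cong (a +_) (*-zeroʳ d)) (+-identityʳ a)

weight-remove : ∀ (c : Fin n → ℕ) {B j} → j ∈ B → ∀ r →
  weight c r (B [ j ]≔ outside) ≡ weight c (suc r) B + (c j ∸ 1) * weight c r B
weight-remove c {B} here zero = sym (+-*-zeroʳ (weight c 1 B) (c zero ∸ 1))
weight-remove c here (suc r)  = refl
weight-remove c {inside ∷ B} {suc j} (there j∈B) zero =
  sym (trans (+-*-zeroʳ (weight (c ∘ suc) zero B) (c (suc j) ∸ 1)) (∈⇒weight0≡0 (c ∘ suc) j∈B))
weight-remove c {inside ∷ B} (there j∈B) (suc r) = weight-remove (c ∘ suc) j∈B r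
weight-remove c {outside ∷ B} {suc j} (there j∈B) zero
  rewrite weight-remove (c ∘ suc) j∈B zero | ∈⇒weight0≡0 (c ∘ suc) j∈B =
  cong (_+ (c (suc j) ∸ 1) * 0) (sym (+-*-zeroʳ (weight (c ∘ suc) 1 B) (c zero ∸ 1)))
weight-remove c {outside ∷ B} {suc j} (there j∈B) (suc r) = begin
  weight (c ∘ suc) (suc r) (B [ j ]≔ outside) + d₀ * weight (c ∘ suc) r (B [ j ]≔ outside)
    ≡⟨ cong₂ (λ u v → u + d₀ * v) (weight-remove (c ∘ suc) j∈B (suc r)) (weight-remove (c ∘ suc) j∈B r) ⟩
  (a + d * b) + d₀ * (b + d * x)
    ≡⟨ solve 5 (λ a b x d d₀ → (a :+ d :* b) :+ d₀ :* (b :+ d :* x) := (a :+ d₀ :* b) :+ d :* (b :+ d₀ :* x))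
             refl a b x d d₀ ⟩
  (a + d₀ * b) + d * (b + d₀ * x) ∎
  where
  open ≡-Reasoning
  open +-*-Solver
  d₀ d a b x : ℕ
  d₀ = c zero ∸ 1
  d = c (suc j) ∸ 1
  a = weight (c ∘ suc) (suc (suc r)) B
  b = weight (c ∘ suc) (suc r) B
  x = weight (c ∘ suc) r B

weight-remove-≥ : ∀ (c : Fin n → ℕ) {B j k} → k ≤ c j ∸ 1 → j ∈ B → ∀ r →
  k * weight c r B ≤ weight c r (B [ j ]≔ outside)
weight-remove-≥ c {B} {j} {k} k≤cⱼ-1 j∈B r = begin
  k * weight c r B                                     ≤⟨ *-monoˡ-≤ (weight c r B) k≤cⱼ-1 ⟩
  (c j ∸ 1) * weight c r B                             ≤⟨ m≤n+m _ (weight c (suc r) B) ⟩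
  weight c (suc r) B + (c j ∸ 1) * weight c r B        ≡⟨ weight-remove c j∈B r ⟨
  weight c r (B [ j ]≔ outside)                        ∎
  where open ≤-Reasoning

weight-antitone : ∀ (c : Fin n → ℕ) → (∀ i → 2 ≤ c i) → ∀ {A A′} → A ⊆ A′ → ∀ r →
  weight c r A′ ≤ weight c r A
weight-antitone c c≥2 {[]}          {[]}           _   r       = ≤-refl
weight-antitone c c≥2 {inside ∷ A}  {outside ∷ A′} A⊆A′ r with A⊆A′ here
... | ()
weight-antitone c c≥2 {inside ∷ A}  {inside ∷ A′}  A⊆A′ zero    = z≤n
weight-antitone c c≥2 {inside ∷ A}  {inside ∷ A′}  A⊆A′ (suc r) =
  weight-antitone (c ∘ suc) (c≥2 ∘ suc) (drop-∷-⊆ A⊆A′) r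
weight-antitone c c≥2 {outside ∷ A} {inside ∷ A′}  A⊆A′ zero    = z≤n
weight-antitone c c≥2 {outside ∷ A} {inside ∷ A′}  A⊆A′ (suc r) = begin
  weight (c ∘ suc) r A′                                           ≤⟨ weight-antitone (c ∘ suc) (c≥2 ∘ suc) (drop-∷-⊆ A⊆A′) r ⟩
  weight (c ∘ suc) r A                                            ≤⟨ m≤n*m _ (c zero ∸ 1) {{>-nonZero (∸-monoˡ-≤ 1 (c≥2 zero))}} ⟩
  (c zero ∸ 1) * weight (c ∘ suc) r A                             ≤⟨ m≤n+m _ _ ⟩
  weight (c ∘ suc) (suc r) A + (c zero ∸ 1) * weight (c ∘ suc) r A ∎
  where open ≤-Reasoning
weight-antitone c c≥2 {outside ∷ A} {outside ∷ A′} A⊆A′ zero    =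
  weight-antitone (c ∘ suc) (c≥2 ∘ suc) (drop-∷-⊆ A⊆A′) zero
weight-antitone c c≥2 {outside ∷ A} {outside ∷ A′} A⊆A′ (suc r) =
  +-mono-≤ (weight-antitone (c ∘ suc) (c≥2 ∘ suc) (drop-∷-⊆ A⊆A′) (suc r))
           (*-monoʳ-≤ (c zero ∸ 1) (weight-antitone (c ∘ suc) (c≥2 ∘ suc) (drop-∷-⊆ A⊆A′) r))

⊆-remove : ∀ {A B : Subset n} {x} → A ⊆ B → x ∉ A → A ⊆ B [ x ]≔ outside
⊆-remove {B = B} {x} A⊆B x∉A {y} y∈A = []≔-minimal B y x (λ { refl → x∉A y∈A }) (A⊆B y∈A)

weight-⊂-halves : ∀ (c : Fin n → ℕ) → (∀ i → 3 ≤ c i) → ∀ {A A′} → A ⊂ A′ → ∀ r →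
  2 * weight c r A′ ≤ weight c r A
weight-⊂-halves c c≥3 {A} {A′} (A⊆A′ , x , x∈A′ , x∉A) r = begin
  2 * weight c r A′               ≤⟨ weight-remove-≥ c (∸-monoˡ-≤ 1 (c≥3 x)) x∈A′ r ⟩
  weight c r (A′ [ x ]≔ outside)  ≤⟨ weight-antitone c (λ i → ≤-trans (n≤1+n 2) (c≥3 i)) (⊆-remove A⊆A′ x∉A) r ⟩
  weight c r A                    ∎
  where open ≤-Reasoning

∉⇒lookup≡outside : ∀ {A : Subset n} {x} → x ∉ A → lookup A x ≡ outside
∉⇒lookup≡outside {A = inside ∷ A}  {zero}  x∉A = contradiction here x∉A
∉⇒lookup≡outside {A = outside ∷ A} {zero}  _   = refl
∉⇒lookup≡outside {A = _ ∷ A}       {suc x} x∉A = ∉⇒lookup≡outside (x∉A ∘ there)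

weight-≤-shift : ∀ (c : Fin n → ℕ) {i j} → c i ≤ c j → i ≢ j → ∀ {A} → j ∈ A → i ∉ A → ∀ r →
  weight c r A ≤ weight c r ((A [ j ]≔ outside) [ i ]≔ inside)
weight-≤-shift c {i} {j} cᵢ≤cⱼ i≢j {A} j∈A i∉A r = begin
  weight c r A                                   ≡⟨ cong (weight c r) B∖i≡A ⟨
  weight c r (B [ i ]≔ outside)                  ≡⟨ weight-remove c ([]≔-updates A i) r ⟩
  weight c (suc r) B + (c i ∸ 1) * weight c r B  ≤⟨ +-monoʳ-≤ _ (*-monoˡ-≤ _ (∸-monoˡ-≤ 1 cᵢ≤cⱼ)) ⟩
  weight c (suc r) B + (c j ∸ 1) * weight c r B  ≡⟨ weight-remove c ([]≔-minimal A j i (i≢j ∘ sym) j∈A) r ⟨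
  weight c r (B [ j ]≔ outside)                  ≡⟨ cong (weight c r) ([]≔-commutes A j i (i≢j ∘ sym)) ⟨
  weight c r ((A [ j ]≔ outside) [ i ]≔ inside)  ∎
  where
  open ≤-Reasoning
  B : Subset _
  B = A [ i ]≔ inside
  B∖i≡A : B [ i ]≔ outside ≡ A
  B∖i≡A = trans ([]≔-idempotent A i)
            (trans (cong (A [ i ]≔_) (sym (∉⇒lookup≡outside i∉A))) ([]≔-lookup A i))

IPSeq-≥-first : ∀ {c : Fin n → ℕ} {k} → IPSeq c → (∀ i → toℕ i ≡ 0 → k ≤ c i) → ∀ i → k ≤ c i
IPSeq-≥-first _            k≤c₁ zero    = k≤c₁ zero refl
IPSeq-≥-first (_ , c-mono) k≤c₁ (suc i) = ≤-trans (k≤c₁ zero refl) (c-mono zero (suc i) z≤n)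

-- Both parts hold for every A and every r.
lemma4p4 : (n : ℕ) (c : Fin n → ℕ) → IPSeq c → (∀ i → toℕ i ≡ 0 → 3 ≤ c i) →
    (r : ℕ) → 1 ≤ r → r ≤ n →
    ((A A′ : Subset n) → ∣ A ∣ ≤ r → ∣ A′ ∣ ≤ r → A ⊂ A′ → 2 * w c r A′ ≤ w c r A)
    × ((A : Subset n) → ∣ A ∣ ≤ r → (i j : Fin n) → i <ᶠ j → w c r A ≤ w c r (δ i j A))
lemma4p4 n c ip@(c≥1 , c-mono) c₁≥3 r _ _ = halving , shifting
  where
  w≡ : ∀ A → w c r A ≡ weight c r A
  w≡ = w≡weight c c≥1 r
  halving : (A A′ : Subset n) → ∣ A ∣ ≤ r → ∣ A′ ∣ ≤ r → A ⊂ A′ → 2 * w c r A′ ≤ w c r A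
  halving A A′ _ _ A⊂A′ =
    subst₂ (λ u v → 2 * u ≤ v) (sym (w≡ A′)) (sym (w≡ A)) (weight-⊂-halves c (IPSeq-≥-first ip c₁≥3) A⊂A′ r)
  shifting : (A : Subset n) → ∣ A ∣ ≤ r → (i j : Fin n) → i <ᶠ j → w c r A ≤ w c r (δ i j A)
  shifting A _ i j i<j with j ∈? A | i ∈? A
  ... | yes j∈A | no i∉A =
    subst₂ _≤_ (sym (w≡ A)) (sym (w≡ _)) (weight-≤-shift c (c-mono i j (<⇒≤ i<j)) (<⇒≢ i<j) j∈A i∉A r)
  ... | yes _ | yes _ = ≤-refl
  ... | no _  | _     = ≤-refl
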